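{- Consider the Number Rotation Puzzle on the $3\times 4$ board with $3\times 3$ rotating blocks, with moves $X$ and $Y$ as described in the context. Let $P_0$ be the set of cells $(i,j)$ with $i+j$ even and $P_1$ the set of cells with $i+j$ odd. Let $S_0$ be the set of all $2$-element subsets of $P_0$, and let $S_1$ be the set of all partitions of $P_1$ into three $2$-element subsets. Any finite sequence of moves $A$ (a permutation of the cells, preserving $P_0$ and $P_1$) acts element-wise on $S_0$ and on $S_1$; write $A\cdot p$ for this action. Then there exists a bijection $\phi: S_0 \to S_1$ such that $\phi(A\cdot p) = A\cdot \phi(p)$ for all $p\in S_0$ and all finite sequences of moves $A$.
   Context: The board has cells $(i,j)$, $1\le i\le 3$ (row from the top), $1\le j\le 4$ (column from the left). The move $X$ rotates the contents of the $3\times3$ block consisting of columns $1$–$3$ by $90^\circ$ counter-clockwise, and $Y$ rotates the contents of the $3\times 3$ block consisting of columns $2$–$4$ by $90^\circ$ counter-clockwise; their inverses are the clockwise rotations. A sequence of moves is viewed as the induced permutation of cell positions, and acts on a set of cells by taking the image of each cell. -}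

module Defs where

open import Data.Fin using (Fin; zero; suc; toℕ; opposite; inject₁; fromℕ)
open import Data.Nat using (ℕ; _+_; _%_)
open import Data.Product using (_×_; _,_; map₂)
open import Data.Sum using (_⊎_)
open import Data.List using (List; []; _∷_)
open import Data.List.Relation.Unary.Any using (Any)
open import Relation.Binary.PropositionalEquality using (_≡_; _≢_)
open import Function using (_⇔_)
open import Data.Empty using (⊥)

-- Cells (i,j) of the 3×4 board, 0-indexed: row i : Fin 3 (from the top),
-- column j : Fin 4 (from the left).  Paper cell (i+1, j+1).
Cell : Set
Cell = Fin 3 × Fin 4

ccw : Fin 3 × Fin 3 → Fin 3 × Fin 3
ccw (r , c) = (opposite c , r)

cw : Fin 3 × Fin 3 → Fin 3 × Fin 3
cw (r , c) = (c , opposite r)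

onLeft : (Fin 3 × Fin 3 → Fin 3 × Fin 3) → Cell → Cell
onLeft f (r , zero) = map₂ inject₁ (f (r , zero))
onLeft f (r , suc zero) = map₂ inject₁ (f (r , suc zero))
onLeft f (r , suc (suc zero)) = map₂ inject₁ (f (r , suc (suc zero)))
onLeft f (r , suc (suc (suc zero))) = (r , suc (suc (suc zero)))

onRight : (Fin 3 × Fin 3 → Fin 3 × Fin 3) → Cell → Cell
onRight f (r , zero) = (r , zero)
onRight f (r , suc c) = map₂ suc (f (r , c))

data Move : Set where
  X Y X⁻¹ Y⁻¹ : Move

-- The permutation of cell positions induced by a single move
-- (a cell is sent to the position its content occupies after the move).
move : Move → Cell → Cell
move X   = onLeft ccw
move Y   = onRight ccw
move X⁻¹ = onLeft cw
move Y⁻¹ = onRight cw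

-- A finite sequence of moves (performed left to right) and its induced permutation.
Moves : Set
Moves = List Move

act : Moves → Cell → Cell
act [] c = c
act (m ∷ ms) c = act ms (move m c)

-- Parity classes: (i,j) with i+j even / odd (1-indexed parity = 0-indexed parity).
InP0 : Cell → Set
InP0 (i , j) = (toℕ i + toℕ j) % 2 ≡ 0

InP1 : Cell → Set
InP1 (i , j) = (toℕ i + toℕ j) % 2 ≡ 1

-- Unordered pairs {a , b} of cells, represented by an ordered pair of cells;
-- two representatives are equal as sets when they have the same elements.
Pair : Set
Pair = Cell × Cell

_∈₂_ : Cell → Pair → Set
x ∈₂ (a , b) = (x ≡ a) ⊎ (x ≡ b)

_≈₂_ : Pair → Pair → Set
p ≈₂ q = ∀ x → (x ∈₂ p) ⇔ (x ∈₂ q)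

IsS0 : Pair → Set
IsS0 (a , b) = a ≢ b × InP0 a × InP0 b

IsP1Pair : Pair → Set
IsP1Pair (a , b) = a ≢ b × InP1 a × InP1 b

-- A triple of blocks; represents the set of its three blocks.
Partition : Set
Partition = Pair × Pair × Pair

blocks : Partition → List Pair
blocks (B₁ , B₂ , B₃) = B₁ ∷ B₂ ∷ B₃ ∷ []

Disjoint : Pair → Pair → Set
Disjoint p q = ∀ x → x ∈₂ p → x ∈₂ q → ⊥

IsS1 : Partition → Set
IsS1 (B₁ , B₂ , B₃) =
  IsP1Pair B₁ × IsP1Pair B₂ × IsP1Pair B₃ ×
  Disjoint B₁ B₂ × Disjoint B₁ B₃ × Disjoint B₂ B₃ ×
  (∀ x → InP1 x → (x ∈₂ B₁) ⊎ (x ∈₂ B₂) ⊎ (x ∈₂ B₃))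

_∈B_ : Pair → Partition → Set
B ∈B π = Any (B ≈₂_) (blocks π)

_≈P_ : Partition → Partition → Set
π ≈P ρ = ∀ B → (B ∈B π) ⇔ (B ∈B ρ)

actPair : Moves → Pair → Pair
actPair A (a , b) = (act A a , act A b)

actPart : Moves → Partition → Partition
actPart A (B₁ , B₂ , B₃) = (actPair A B₁ , actPair A B₂ , actPair A B₃)

-- Apart from equivariance every clause quantifies over finitely many cells and is
-- decided by evaluation.  Equivariance under arbitrary move sequences reduces to
-- the four single moves: both actions are composites of single-move actions, and
-- these respect set equality of pairs and of partitions.
module Submission where

open import Defs
open import Data.Fin using (zero; suc; toℕ; _≟_)
open import Data.Fin.Properties using (all?; any?)
import Data.Nat as ℕ
open import Data.Product using (Σ; ∃; _×_; _,_; uncurry; curry)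
open import Data.Product.Properties using (≡-dec)
open import Data.Sum using (inj₁; inj₂)
open import Data.List using ([]; _∷_)
open import Relation.Binary.Definitions using (Decidable; DecidableEquality)
open import Relation.Binary.Structures using (IsEquivalence)
open import Relation.Binary.Bundles using (Setoid; DecSetoid)
open import Relation.Binary.PropositionalEquality using (refl)
open import Relation.Nullary.Decidable using (Dec; map′; ¬?; _×-dec_; _⊎-dec_; _→-dec_; from-yes)
open import Function using (_⇔_; mk⇔; Equivalence)
import Function.Properties.Equivalence as ⇔
import Data.List.Relation.Binary.Subset.Setoid.Properties as Subset

open Equivalence

pattern c00 = (zero , zero)
pattern c01 = (zero , suc zero)
pattern c02 = (zero , suc (suc zero))
pattern c03 = (zero , suc (suc (suc zero)))
pattern c10 = (suc zero , zero)
pattern c11 = (suc zero , suc zero)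
pattern c12 = (suc zero , suc (suc zero))
pattern c13 = (suc zero , suc (suc (suc zero)))
pattern c20 = (suc (suc zero) , zero)
pattern c21 = (suc (suc zero) , suc zero)
pattern c22 = (suc (suc zero) , suc (suc zero))
pattern c23 = (suc (suc zero) , suc (suc (suc zero)))

module _ {A B : Set} {P : A × B → Set} where

  ∀-uncurry? : Dec (∀ a b → P (a , b)) → Dec (∀ x → P x)
  ∀-uncurry? = map′ uncurry curry

  ∃-uncurry? : Dec (∃ λ a → ∃ λ b → P (a , b)) → Dec (∃ P)
  ∃-uncurry? = map′ (λ (a , b , pab) → (a , b) , pab) (λ ((a , b) , pab) → a , b , pab)

∀-cell? : {P : Cell → Set} → (∀ c → Dec (P c)) → Dec (∀ c → P c)
∀-cell? P? = ∀-uncurry? (all? λ i → all? λ j → P? (i , j))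

∃-cell? : {P : Cell → Set} → (∀ c → Dec (P c)) → Dec (∃ P)
∃-cell? P? = ∃-uncurry? (any? λ i → any? λ j → P? (i , j))

∀-pair? : {P : Pair → Set} → (∀ p → Dec (P p)) → Dec (∀ p → P p)
∀-pair? P? = ∀-uncurry? (∀-cell? λ a → ∀-cell? λ b → P? (a , b))

∃-pair? : {P : Pair → Set} → (∀ p → Dec (P p)) → Dec (∃ P)
∃-pair? P? = ∃-uncurry? (∃-cell? λ a → ∃-cell? λ b → P? (a , b))

∀-move? : {P : Move → Set} → (∀ m → Dec (P m)) → Dec (∀ m → P m)
∀-move? P? = map′ (λ (x , y , x⁻¹ , y⁻¹) → λ { X → x ; Y → y ; X⁻¹ → x⁻¹ ; Y⁻¹ → y⁻¹ })
                  (λ h → h X , h Y , h X⁻¹ , h Y⁻¹)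
                  (P? X ×-dec P? Y ×-dec P? X⁻¹ ×-dec P? Y⁻¹)

_≟ᶜ_ : DecidableEquality Cell
_≟ᶜ_ = ≡-dec _≟_ _≟_

InP0? : ∀ c → Dec (InP0 c)
InP0? (i , j) = (toℕ i ℕ.+ toℕ j) ℕ.% 2 ℕ.≟ 0

InP1? : ∀ c → Dec (InP1 c)
InP1? (i , j) = (toℕ i ℕ.+ toℕ j) ℕ.% 2 ℕ.≟ 1

_∈₂?_ : ∀ x p → Dec (x ∈₂ p)
x ∈₂? (a , b) = x ≟ᶜ a ⊎-dec x ≟ᶜ b

≈₂-intro : ∀ {a b c d} → a ∈₂ (c , d) → b ∈₂ (c , d) → c ∈₂ (a , b) → d ∈₂ (a , b) →
           (a , b) ≈₂ (c , d)
≈₂-intro a∈ b∈ c∈ d∈ x = mk⇔ (λ { (inj₁ refl) → a∈ ; (inj₂ refl) → b∈ })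
                              (λ { (inj₁ refl) → c∈ ; (inj₂ refl) → d∈ })

_≈₂?_ : Decidable _≈₂_
p@(a , b) ≈₂? q@(c , d) =
  map′ (λ (a∈ , b∈ , c∈ , d∈) → ≈₂-intro a∈ b∈ c∈ d∈)
       (λ h → to (h a) (inj₁ refl) , to (h b) (inj₂ refl) , from (h c) (inj₁ refl) , from (h d) (inj₂ refl))
       (a ∈₂? q ×-dec b ∈₂? q ×-dec c ∈₂? p ×-dec d ∈₂? p)

ext-isEquivalence : {E S : Set} (_∈_ : E → S → Set) → IsEquivalence (λ s t → ∀ x → (x ∈ s) ⇔ (x ∈ t))
ext-isEquivalence _ = record
  { refl  = λ x → ⇔.refl
  ; sym   = λ s≈t x → ⇔.sym (s≈t x)
  ; trans = λ s≈t t≈u x → ⇔.trans (s≈t x) (t≈u x)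
  }

pair-decSetoid : DecSetoid _ _
pair-decSetoid = record
  { Carrier = Pair
  ; _≈_ = _≈₂_
  ; isDecEquivalence = record { isEquivalence = ext-isEquivalence _∈₂_ ; _≟_ = _≈₂?_ }
  }

pair-setoid : Setoid _ _
pair-setoid = DecSetoid.setoid pair-decSetoid

open import Data.List.Relation.Binary.Subset.DecSetoid pair-decSetoid using (_⊆_; _⊆?_)

≈P-isEquivalence : IsEquivalence _≈P_
≈P-isEquivalence = ext-isEquivalence _∈B_

≈P⇔⊆⊇ : ∀ {π ρ} → π ≈P ρ ⇔ (blocks π ⊆ blocks ρ × blocks ρ ⊆ blocks π)
≈P⇔⊆⊇ = mk⇔ (λ h → (λ {B} → to (h B)) , (λ {B} → from (h B)))
             (λ (π⊆ρ , ρ⊆π) B → mk⇔ (λ B∈π → π⊆ρ B∈π) (λ B∈ρ → ρ⊆π B∈ρ))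

_≈P?_ : Decidable _≈P_
π ≈P? ρ = map′ (from ≈P⇔⊆⊇) (to ≈P⇔⊆⊇) (blocks π ⊆? blocks ρ ×-dec blocks ρ ⊆? blocks π)

act-∈₂ : ∀ A {x p} → x ∈₂ p → act A x ∈₂ actPair A p
act-∈₂ A (inj₁ refl) = inj₁ refl
act-∈₂ A (inj₂ refl) = inj₂ refl

actPair-resp-≈₂ : ∀ A {p q} → p ≈₂ q → actPair A p ≈₂ actPair A q
actPair-resp-≈₂ A {a , b} {c , d} h =
  ≈₂-intro (act-∈₂ A (to (h a) (inj₁ refl))) (act-∈₂ A (to (h b) (inj₂ refl)))
           (act-∈₂ A (from (h c) (inj₁ refl))) (act-∈₂ A (from (h d) (inj₂ refl)))

actPart-resp-≈P : ∀ A {π ρ} → π ≈P ρ → actPart A π ≈P actPart A ρ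
actPart-resp-≈P A h with π⊆ρ , ρ⊆π ← to ≈P⇔⊆⊇ h =
  from ≈P⇔⊆⊇ ( Subset.map⁺ pair-setoid pair-setoid (actPair-resp-≈₂ A) π⊆ρ
              , Subset.map⁺ pair-setoid pair-setoid (actPair-resp-≈₂ A) ρ⊆π )

module _ (f : Pair → Partition) (S : Pair → Set)
         (S-closed : ∀ m p → S p → S (actPair (m ∷ []) p))
         (move-equivariant : ∀ m p → S p → f (actPair (m ∷ []) p) ≈P actPart (m ∷ []) (f p)) where

  open IsEquivalence ≈P-isEquivalence renaming (refl to ≈P-refl; trans to ≈P-trans)

  -- act (m ∷ A) unfolds definitionally to act A ∘ move m, on both sides.
  sequence-equivariant : ∀ A p → S p → f (actPair A p) ≈P actPart A (f p)
  sequence-equivariant []      p s = ≈P-refl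
  sequence-equivariant (m ∷ A) p s =
    ≈P-trans (sequence-equivariant A (actPair (m ∷ []) p) (S-closed m p s))
             (actPart-resp-≈P A (move-equivariant m p s))

IsS0? : ∀ p → Dec (IsS0 p)
IsS0? (a , b) = ¬? (a ≟ᶜ b) ×-dec InP0? a ×-dec InP0? b

IsP1Pair? : ∀ p → Dec (IsP1Pair p)
IsP1Pair? (a , b) = ¬? (a ≟ᶜ b) ×-dec InP1? a ×-dec InP1? b

Disjoint? : ∀ p q → Dec (Disjoint p q)
Disjoint? (a , b) q =
  map′ (λ (a∉ , b∉) → λ { _ (inj₁ refl) → a∉ ; _ (inj₂ refl) → b∉ })
       (λ d → d a (inj₁ refl) , d b (inj₂ refl))
       (¬? (a ∈₂? q) ×-dec ¬? (b ∈₂? q))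

IsS1? : ∀ π → Dec (IsS1 π)
IsS1? (B₁ , B₂ , B₃) =
  IsP1Pair? B₁ ×-dec IsP1Pair? B₂ ×-dec IsP1Pair? B₃ ×-dec
  Disjoint? B₁ B₂ ×-dec Disjoint? B₁ B₃ ×-dec Disjoint? B₂ B₃ ×-dec
  ∀-cell? (λ x → InP1? x →-dec (x ∈₂? B₁ ⊎-dec x ∈₂? B₂ ⊎-dec x ∈₂? B₃))

φ : Pair → Partition
φ (c00 , c02) = (c01 , c21) , (c12 , c23) , (c03 , c10)
φ (c02 , c00) = (c01 , c21) , (c12 , c23) , (c03 , c10)
φ (c00 , c20) = (c10 , c12) , (c01 , c23) , (c03 , c21)
φ (c20 , c00) = (c10 , c12) , (c01 , c23) , (c03 , c21)
φ (c00 , c11) = (c03 , c12) , (c01 , c10) , (c21 , c23)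
φ (c11 , c00) = (c03 , c12) , (c01 , c10) , (c21 , c23)
φ (c11 , c20) = (c01 , c03) , (c12 , c23) , (c10 , c21)
φ (c20 , c11) = (c01 , c03) , (c12 , c23) , (c10 , c21)
φ (c00 , c22) = (c10 , c21) , (c03 , c23) , (c01 , c12)
φ (c22 , c00) = (c10 , c21) , (c03 , c23) , (c01 , c12)
φ (c02 , c20) = (c12 , c21) , (c01 , c10) , (c03 , c23)
φ (c20 , c02) = (c12 , c21) , (c01 , c10) , (c03 , c23)
φ (c00 , c13) = (c01 , c03) , (c10 , c23) , (c12 , c21)
φ (c13 , c00) = (c01 , c03) , (c10 , c23) , (c12 , c21)
φ (c13 , c20) = (c01 , c12) , (c21 , c23) , (c03 , c10)
φ (c20 , c13) = (c01 , c12) , (c21 , c23) , (c03 , c10)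
φ (c13 , c22) = (c01 , c10) , (c12 , c23) , (c03 , c21)
φ (c22 , c13) = (c01 , c10) , (c12 , c23) , (c03 , c21)
φ (c02 , c13) = (c03 , c12) , (c01 , c23) , (c10 , c21)
φ (c13 , c02) = (c03 , c12) , (c01 , c23) , (c10 , c21)
φ (c02 , c11) = (c10 , c23) , (c01 , c12) , (c03 , c21)
φ (c11 , c02) = (c10 , c23) , (c01 , c12) , (c03 , c21)
φ (c11 , c22) = (c12 , c21) , (c01 , c23) , (c03 , c10)
φ (c22 , c11) = (c12 , c21) , (c01 , c23) , (c03 , c10)
φ (c20 , c22) = (c01 , c21) , (c10 , c23) , (c03 , c12)
φ (c22 , c20) = (c01 , c21) , (c10 , c23) , (c03 , c12)
φ (c02 , c22) = (c10 , c12) , (c21 , c23) , (c01 , c03)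
φ (c22 , c02) = (c10 , c12) , (c21 , c23) , (c01 , c03)
φ (c11 , c13) = (c10 , c12) , (c03 , c23) , (c01 , c21)
φ (c13 , c11) = (c10 , c12) , (c03 , c23) , (c01 , c21)
-- Junk value: φ is only meaningful on S0.
φ _           = (c00 , c00) , (c00 , c00) , (c00 , c00)

φ-maps-into : ∀ p → IsS0 p → IsS1 (φ p)
φ-maps-into = from-yes (∀-pair? λ p → IsS0? p →-dec IsS1? (φ p))

φ-respects-≈₂ : ∀ p q → IsS0 p → IsS0 q → p ≈₂ q → φ p ≈P φ q
φ-respects-≈₂ = from-yes (∀-pair? λ p → ∀-pair? λ q →
  IsS0? p →-dec IsS0? q →-dec p ≈₂? q →-dec φ p ≈P? φ q)

φ-injective : ∀ p q → IsS0 p → IsS0 q → φ p ≈P φ q → p ≈₂ q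
φ-injective = from-yes (∀-pair? λ p → ∀-pair? λ q →
  IsS0? p →-dec IsS0? q →-dec φ p ≈P? φ q →-dec p ≈₂? q)

moves-preserve-S0 : ∀ m p → IsS0 p → IsS0 (actPair (m ∷ []) p)
moves-preserve-S0 = from-yes (∀-move? λ m → ∀-pair? λ p → IsS0? p →-dec IsS0? (actPair (m ∷ []) p))

φ-move-equivariant : ∀ m p → IsS0 p → φ (actPair (m ∷ []) p) ≈P actPart (m ∷ []) (φ p)
φ-move-equivariant = from-yes (∀-move? λ m → ∀-pair? λ p →
  IsS0? p →-dec φ (actPair (m ∷ []) p) ≈P? actPart (m ∷ []) (φ p))

-- Three disjoint pairs in the six cells of P1 cover P1 automatically, so the
-- covering clause of IsS1 is dropped and the search is pruned block by block.
φ-hits-disjoint-triples :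
  ∀ B₁ → IsP1Pair B₁ →
  ∀ B₂ → IsP1Pair B₂ × Disjoint B₁ B₂ →
  ∀ B₃ → IsP1Pair B₃ × Disjoint B₁ B₃ × Disjoint B₂ B₃ →
  ∃ λ p → IsS0 p × (φ p ≈P (B₁ , B₂ , B₃))
φ-hits-disjoint-triples = from-yes
  (∀-pair? λ B₁ → IsP1Pair? B₁ →-dec
   ∀-pair? λ B₂ → (IsP1Pair? B₂ ×-dec Disjoint? B₁ B₂) →-dec
   ∀-pair? λ B₃ → (IsP1Pair? B₃ ×-dec Disjoint? B₁ B₃ ×-dec Disjoint? B₂ B₃) →-dec
   ∃-pair? λ p → IsS0? p ×-dec φ p ≈P? (B₁ , B₂ , B₃))

φ-surjective : ∀ π → IsS1 π → ∃ λ p → IsS0 p × (φ p ≈P π)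
φ-surjective (B₁ , B₂ , B₃) (B₁∈ , B₂∈ , B₃∈ , B₁∩B₂ , B₁∩B₃ , B₂∩B₃ , _) =
  φ-hits-disjoint-triples B₁ B₁∈ B₂ (B₂∈ , B₁∩B₂) B₃ (B₃∈ , B₁∩B₃ , B₂∩B₃)

mainTheorem2 : Σ (Pair → Partition) λ φ →
    (∀ p → IsS0 p → IsS1 (φ p)) ×
    (∀ p q → IsS0 p → IsS0 q → p ≈₂ q → φ p ≈P φ q) ×
    (∀ p q → IsS0 p → IsS0 q → φ p ≈P φ q → p ≈₂ q) ×
    (∀ π → IsS1 π → ∃ λ p → IsS0 p × (φ p ≈P π)) ×
    (∀ (A : Moves) p → IsS0 p → φ (actPair A p) ≈P actPart A (φ p))
mainTheorem2 = φ , φ-maps-into , φ-respects-≈₂ , φ-injective , φ-surjective ,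
  sequence-equivariant φ IsS0 moves-preserve-S0 φ-move-equivariant
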